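{- Let $n$ be odd, $U=V(n,2)$ with a nondegenerate symmetric bilinear form $\mathsf b$, let $\Sigma$ be an additively closed symplectic spread-set of $U$ with canonical labeling $C$, and let $u\in U$. Define $C_u(a)=C(a)+E_{a,u}+E_{u,a}$, $B(a)=C(a)+E_{a,a}$ and $B_u(a)=C_u(a)+E_{a,a}$ for $a\in U$. Then $B_u(a)=B(a+u)+B(u)$ for all $a\in U$.
   Context: Operators act on the right; $xE_{a,b}=\mathsf b(x,a)b$. A symplectic spread-set of $U$ is a set of $2^n$ self-adjoint operators containing $0$ with $L+L'$ invertible for all distinct members. Its canonical labeling is the unique bijection $C:U\to\Sigma$ with $C(a)+E_{a,a}$ skew-symmetric (i.e. $\mathsf b(x,x(C(a)+E_{a,a}))=0$ for all $x$) for every $a\in U$. (The set $\{C_u(a)\}$ is the $u$-twist of $\Sigma$, and $\{B(a)\}$, $\{B_u(a)\}$ are the shadows of $\Sigma$ and of its $u$-twist.) -}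

module Defs where

open import Data.Nat using (ℕ; suc; _*_; _^_)
open import Data.Bool using (Bool; true; false; _xor_; _∧_)
open import Data.Fin using (Fin)
import Data.Fin as Fin
open import Data.Vec using (Vec; []; _∷_; zipWith; map; replicate; tabulate)
open import Data.List using (List; length)
open import Data.List.Membership.Propositional using (_∈_)
open import Data.List.Relation.Unary.Unique.Propositional using (Unique)
open import Data.Product using (Σ; ∃; _×_; _,_)
open import Relation.Nullary using (¬_; does)
open import Relation.Binary.PropositionalEquality using (_≡_; _≢_)
open import Function.Bundles using (_⇔_)

Odd : ℕ → Set
Odd n = ∃ λ k → n ≡ suc (2 * k)

-- GF(2) = Bool with xor (+) and ∧ (·).
-- U = V(n,2): row vectors of length n over GF(2).
U : ℕ → Set
U n = Vec Bool n

_+ᵥ_ : ∀ {n} → U n → U n → U n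
_+ᵥ_ = zipWith _xor_

0ᵥ : ∀ {n} → U n
0ᵥ = replicate _ false

scale : ∀ {n} → Bool → U n → U n
scale c v = map (c ∧_) v

vsum : ∀ {m n} → Vec (U n) m → U n
vsum []       = 0ᵥ
vsum (v ∷ vs) = v +ᵥ vsum vs

basis : ∀ {n} → Fin n → U n
basis i = tabulate (λ j → does (i Fin.≟ j))

-- Operators on U: n×n matrices (list of rows), acting on the RIGHT of row vectors.
Op : ℕ → Set
Op n = Vec (U n) n

_·_ : ∀ {n} → U n → Op n → U n
x · L = vsum (zipWith scale x L)

_+ₒ_ : ∀ {n} → Op n → Op n → Op n
_+ₒ_ = zipWith _+ᵥ_

0ₒ : ∀ {n} → Op n
0ₒ = replicate _ 0ᵥ

record IsNondegSymBilinear {n : ℕ} (b : U n → U n → Bool) : Set where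
  field
    additiveˡ    : ∀ x y z → b (x +ᵥ y) z ≡ b x z xor b y z
    additiveʳ    : ∀ x y z → b x (y +ᵥ z) ≡ b x y xor b x z
    symmetric    : ∀ x y → b x y ≡ b y x
    nondegenerate : ∀ x → (∀ y → b x y ≡ false) → x ≡ 0ᵥ

-- E_{a,c} : x ↦ b(x,a) c, as the matrix whose i-th row is e_i E_{a,c}
E : ∀ {n} → (U n → U n → Bool) → U n → U n → Op n
E b a c = tabulate (λ i → scale (b (basis i) a) c)

SelfAdjoint : ∀ {n} → (U n → U n → Bool) → Op n → Set
SelfAdjoint b L = ∀ x y → b (x · L) y ≡ b x (y · L)

Invertible : ∀ {n} → Op n → Set
Invertible L = ∃ λ M → (∀ x → (x · L) · M ≡ x) × (∀ x → (x · M) · L ≡ x)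

SkewSymmetric : ∀ {n} → (U n → U n → Bool) → Op n → Set
SkewSymmetric b L = ∀ x → b x (x · L) ≡ false

record IsSymplecticSpreadSet {n : ℕ} (b : U n → U n → Bool) (S : Op n → Set) : Set where
  field
    cardinality : ∃ λ (xs : List (Op n)) →
                    Unique xs × (length xs ≡ 2 ^ n) × (∀ L → (S L ⇔ (L ∈ xs)))
    selfAdjoint : ∀ L → S L → SelfAdjoint b L
    containsZero : S 0ₒ
    spread : ∀ L L' → S L → S L' → L ≢ L' → Invertible (L +ₒ L')

AdditivelyClosed : ∀ {n} → (Op n → Set) → Set
AdditivelyClosed S = ∀ L L' → S L → S L' → S (L +ₒ L')

record IsCanonicalLabeling {n : ℕ} (b : U n → U n → Bool) (S : Op n → Set)
                           (C : U n → Op n) : Set where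
  field
    into       : ∀ a → S (C a)
    injective  : ∀ a a' → C a ≡ C a' → a ≡ a'
    surjective : ∀ L → S L → ∃ λ a → C a ≡ L
    skew       : ∀ a → SkewSymmetric b (C a +ₒ E b a a)

Cᵤ : ∀ {n} → (U n → U n → Bool) → (U n → Op n) → U n → U n → Op n
Cᵤ b C u a = (C a +ₒ E b a u) +ₒ E b u a

B : ∀ {n} → (U n → U n → Bool) → (U n → Op n) → U n → Op n
B b C a = C a +ₒ E b a a

Bᵤ : ∀ {n} → (U n → U n → Bool) → (U n → Op n) → U n → U n → Op n
Bᵤ b C u a = Cᵤ b C u a +ₒ E b a a

module Submission where

-- Skew-symmetry of C(a) + E_{a,a} says b(x, x C(a)) = b(x, a) for all x, because
-- b(x, x E_{a,a}) = b(x,a)² = b(x,a). By additive closure C(a) + C(u) = C(w) for some w,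
-- and then b(x, w) = b(x, a + u) for all x, so w = a + u by nondegeneracy: C is additive.
-- The identity is then a rearrangement using bilinearity of (a, c) ↦ E_{a,c} in characteristic 2.

open import Defs
open import Algebra.Bundles using (AbelianGroup; CommutativeRing)
open import Algebra.Structures using (IsAbelianGroup)
open import Data.Bool using (Bool; true; false; _xor_; _∧_)
open import Data.Bool.Properties
  using (xor-∧-commutativeRing; xor-identityʳ; xor-same; ∧-assoc; ∧-zeroʳ; ∧-idem; ∧-identityʳ; ∧-distribˡ-xor; ∧-distribʳ-xor)
open import Data.Fin as Fin using ()
open import Data.Nat using (ℕ; zero; suc)
open import Data.Product using (_,_)
open import Data.Vec using (Vec; []; _∷_; zipWith; map; replicate; tabulate)
open import Data.Vec.Properties
  using (zipWith-assoc; zipWith-comm; zipWith-identityˡ; zipWith-identityʳ; zipWith-inverseˡ; zipWith-inverseʳ;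
         map-id; map-replicate; tabulate-∘; tabulate-cong)
open import Function using (id; _∘_)
open import Level using (0ℓ)
open import Relation.Binary.PropositionalEquality
  using (_≡_; refl; sym; trans; cong; cong₂; isEquivalence; module ≡-Reasoning)

open ≡-Reasoning

private variable
  m m′ k : ℕ

xor-abelianGroup : AbelianGroup 0ℓ 0ℓ
xor-abelianGroup = CommutativeRing.+-abelianGroup xor-∧-commutativeRing

zipWith-isAbelianGroup : ∀ {A : Set} {_∙_ : A → A → A} {ε : A} {m} →
  IsAbelianGroup _≡_ _∙_ ε id → IsAbelianGroup _≡_ (zipWith {n = m} _∙_) (replicate m ε) id
zipWith-isAbelianGroup G = record
  { isGroup = record
    { isMonoid = record
      { isSemigroup = record
        { isMagma = record { isEquivalence = isEquivalence ; ∙-cong = cong₂ _ }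
        ; assoc = zipWith-assoc assoc }
      ; identity = zipWith-identityˡ identityˡ , zipWith-identityʳ identityʳ }
    ; inverse = (λ xs → trans (cong (λ ys → zipWith _ ys xs) (sym (map-id xs))) (zipWith-inverseˡ inverseˡ xs))
              , (λ xs → trans (cong (zipWith _ xs) (sym (map-id xs))) (zipWith-inverseʳ inverseʳ xs))
    ; ⁻¹-cong = id }
  ; comm = zipWith-comm comm }
  where open IsAbelianGroup G using (assoc; identityˡ; identityʳ; inverseˡ; inverseʳ; comm)

+ᵥ-abelianGroup : ℕ → AbelianGroup 0ℓ 0ℓ
+ᵥ-abelianGroup n =
  record { isAbelianGroup = zipWith-isAbelianGroup {m = n} (AbelianGroup.isAbelianGroup xor-abelianGroup) }

+ₒ-abelianGroup : ℕ → AbelianGroup 0ℓ 0ℓ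
+ₒ-abelianGroup n =
  record { isAbelianGroup = zipWith-isAbelianGroup {m = n} (AbelianGroup.isAbelianGroup (+ᵥ-abelianGroup n)) }

module +ᵥ {n : ℕ} where
  open AbelianGroup (+ᵥ-abelianGroup n) public
  open import Algebra.Properties.Group group public using (x∙y⁻¹≈ε⇒x≈y)
  open import Algebra.Properties.CommutativeSemigroup commutativeSemigroup public using (interchange)

module +ₒ {n : ℕ} where
  open AbelianGroup (+ₒ-abelianGroup n) public
  open import Algebra.Properties.Group group public using (//-rightDividesʳ)
  open import Algebra.Solver.CommutativeMonoid commutativeMonoid public using (solve; _⊕_; _⊜_)

module xor where
  open import Algebra.Properties.Group (AbelianGroup.group xor-abelianGroup) public using (x∙y⁻¹≈ε⇒x≈y)

scale-false : (v : U m) → scale false v ≡ 0ᵥ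
scale-false []      = refl
scale-false (_ ∷ v) = cong (false ∷_) (scale-false v)

scale-true : (v : U m) → scale true v ≡ v
scale-true = map-id

scale-0ᵥ : ∀ {m} t → scale t (0ᵥ {m}) ≡ 0ᵥ
scale-0ᵥ {m} t = trans (map-replicate (t ∧_) false m) (cong (replicate m) (∧-zeroʳ t))

scale-distribʳ-xor : ∀ s t (v : U m) → scale (s xor t) v ≡ scale s v +ᵥ scale t v
scale-distribʳ-xor s t []      = refl
scale-distribʳ-xor s t (x ∷ v) = cong₂ _∷_ (∧-distribʳ-xor x s t) (scale-distribʳ-xor s t v)

scale-distribˡ-+ᵥ : ∀ t (v w : U m) → scale t (v +ᵥ w) ≡ scale t v +ᵥ scale t w
scale-distribˡ-+ᵥ t []      []      = refl
scale-distribˡ-+ᵥ t (x ∷ v) (y ∷ w) = cong₂ _∷_ (∧-distribˡ-xor t x y) (scale-distribˡ-+ᵥ t v w)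

scale-∧ : ∀ s t (v : U m) → scale s (scale t v) ≡ scale (s ∧ t) v
scale-∧ s t []      = refl
scale-∧ s t (x ∷ v) = cong₂ _∷_ (sym (∧-assoc s t x)) (scale-∧ s t v)

combination : Vec Bool k → Vec (U m) k → U m
combination x L = vsum (zipWith scale x L)

record IsLinear (φ : U m → U m′) : Set where
  field
    additive    : ∀ v w → φ (v +ᵥ w) ≡ φ v +ᵥ φ w
    homogeneous : ∀ t v → φ (scale t v) ≡ scale t (φ v)

  preserves-0ᵥ : φ 0ᵥ ≡ 0ᵥ
  preserves-0ᵥ = begin
    φ 0ᵥ                ≡⟨ cong φ (scale-false 0ᵥ) ⟨
    φ (scale false 0ᵥ)  ≡⟨ homogeneous false 0ᵥ ⟩
    scale false (φ 0ᵥ)  ≡⟨ scale-false (φ 0ᵥ) ⟩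
    0ᵥ                  ∎

  combination-map : (x : Vec Bool k) (L : Vec (U m) k) → combination x (map φ L) ≡ φ (combination x L)
  combination-map []      []      = sym preserves-0ᵥ
  combination-map (c ∷ x) (l ∷ L) = begin
    scale c (φ l) +ᵥ combination x (map φ L)  ≡⟨ cong₂ _+ᵥ_ (sym (homogeneous c l)) (combination-map x L) ⟩
    φ (scale c l) +ᵥ φ (combination x L)      ≡⟨ additive (scale c l) (combination x L) ⟨
    φ (combination (c ∷ x) (l ∷ L))           ∎

combination-distrib : (x : Vec Bool k) (L M : Vec (U m) k) →
  combination x (zipWith _+ᵥ_ L M) ≡ combination x L +ᵥ combination x M
combination-distrib []      []      []       = sym (+ᵥ.identityˡ 0ᵥ)
combination-distrib (c ∷ x) (l ∷ L) (l′ ∷ M) = begin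
  scale c (l +ᵥ l′) +ᵥ combination x (zipWith _+ᵥ_ L M)
    ≡⟨ cong₂ _+ᵥ_ (scale-distribˡ-+ᵥ c l l′) (combination-distrib x L M) ⟩
  (scale c l +ᵥ scale c l′) +ᵥ (combination x L +ᵥ combination x M)
    ≡⟨ +ᵥ.interchange (scale c l) (scale c l′) (combination x L) (combination x M) ⟩
  combination (c ∷ x) (l ∷ L) +ᵥ combination (c ∷ x) (l′ ∷ M)
    ∎

consFalse-isLinear : IsLinear {m} (false ∷_)
consFalse-isLinear = record
  { additive    = λ v w → refl
  ; homogeneous = λ t v → cong (_∷ scale t v) (sym (∧-zeroʳ t)) }

tabulate-const : {A : Set} (a : A) → tabulate {n = m} (λ _ → a) ≡ replicate m a
tabulate-const {zero}  a = refl
tabulate-const {suc m} a = cong (a ∷_) (tabulate-const a)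

basis-zero : basis {suc m} Fin.zero ≡ true ∷ 0ᵥ
basis-zero = cong (true ∷_) (tabulate-const false)

combination-basis : (x : U m) → combination x (tabulate basis) ≡ x
combination-basis []      = refl
combination-basis (c ∷ x) = begin
  scale c (basis Fin.zero) +ᵥ combination x (tabulate (basis ∘ Fin.suc))
    ≡⟨ cong₂ (λ e L → scale c e +ᵥ combination x L) basis-zero (tabulate-∘ (false ∷_) basis) ⟩
  scale c (true ∷ 0ᵥ) +ᵥ combination x (map (false ∷_) (tabulate basis))
    ≡⟨ cong (scale c (true ∷ 0ᵥ) +ᵥ_) (IsLinear.combination-map consFalse-isLinear x (tabulate basis)) ⟩
  ((c ∧ true) xor false) ∷ (scale c 0ᵥ +ᵥ combination x (tabulate basis))
    ≡⟨ cong₂ _∷_ (trans (xor-identityʳ _) (∧-identityʳ c)) (trans (cong (_+ᵥ _) (scale-0ᵥ c)) (+ᵥ.identityˡ _)) ⟩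
  c ∷ combination x (tabulate basis)
    ≡⟨ cong (c ∷_) (combination-basis x) ⟩
  c ∷ x
    ∎

zipWith-tabulate : {A B C : Set} (f : A → B → C) (g : Fin.Fin m → A) (h : Fin.Fin m → B) →
  zipWith f (tabulate g) (tabulate h) ≡ tabulate (λ i → f (g i) (h i))
zipWith-tabulate {zero}  f g h = refl
zipWith-tabulate {suc m} f g h = cong (_ ∷_) (zipWith-tabulate f (g ∘ Fin.suc) (h ∘ Fin.suc))

module Bilinear {n : ℕ} {b : U n → U n → Bool} (bl : IsNondegSymBilinear b) where
  open IsNondegSymBilinear bl

  zeroˡ : ∀ a → b 0ᵥ a ≡ false
  zeroˡ a = begin
    b 0ᵥ a                   ≡⟨ cong (λ v → b v a) (+ᵥ.identityˡ 0ᵥ) ⟨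
    b (0ᵥ +ᵥ 0ᵥ) a           ≡⟨ additiveˡ 0ᵥ 0ᵥ a ⟩
    b 0ᵥ a xor b 0ᵥ a        ≡⟨ xor-same (b 0ᵥ a) ⟩
    false                    ∎

  scaleˡ : ∀ t v a → b (scale t v) a ≡ t ∧ b v a
  scaleˡ false v a = trans (cong (λ w → b w a) (scale-false v)) (zeroˡ a)
  scaleˡ true  v a = cong (λ w → b w a) (scale-true v)

  scaleʳ : ∀ t x v → b x (scale t v) ≡ t ∧ b x v
  scaleʳ t x v = trans (symmetric x _) (trans (scaleˡ t v x) (cong (t ∧_) (symmetric v x)))

  separating : ∀ v w → (∀ x → b x v ≡ b x w) → v ≡ w
  separating v w same = +ᵥ.x∙y⁻¹≈ε⇒x≈y v w (nondegenerate (v +ᵥ w) orthogonal)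
    where
    orthogonal : ∀ y → b (v +ᵥ w) y ≡ false
    orthogonal y = begin
      b (v +ᵥ w) y       ≡⟨ additiveˡ v w y ⟩
      b v y xor b w y    ≡⟨ cong₂ _xor_ (trans (symmetric v y) (same y)) (symmetric w y) ⟩
      b y w xor b y w    ≡⟨ xor-same (b y w) ⟩
      false              ∎

  ·-E : ∀ x a c → x · E b a c ≡ scale (b x a) c
  ·-E x a c = begin
    combination x (tabulate (φ ∘ basis))   ≡⟨ cong (combination x) (tabulate-∘ φ basis) ⟩
    combination x (map φ (tabulate basis)) ≡⟨ IsLinear.combination-map φ-isLinear x (tabulate basis) ⟩
    φ (combination x (tabulate basis))     ≡⟨ cong φ (combination-basis x) ⟩
    φ x                                    ∎
    where
    φ : U n → U n
    φ v = scale (b v a) c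
    φ-isLinear : IsLinear φ
    φ-isLinear = record
      { additive    = λ v w → trans (cong (λ t → scale t c) (additiveˡ v w a)) (scale-distribʳ-xor _ _ c)
      ; homogeneous = λ t v → trans (cong (λ s → scale s c) (scaleˡ t v a)) (sym (scale-∧ t (b v a) c)) }

  skew-shift : ∀ L a → SkewSymmetric b (L +ₒ E b a a) → ∀ x → b x (x · L) ≡ b x a
  skew-shift L a skew x = xor.x∙y⁻¹≈ε⇒x≈y _ _ (begin
    b x (x · L) xor b x a                     ≡⟨ cong (b x (x · L) xor_) (∧-idem (b x a)) ⟨
    b x (x · L) xor (b x a ∧ b x a)           ≡⟨ cong (b x (x · L) xor_) (scaleʳ (b x a) x a) ⟨
    b x (x · L) xor b x (scale (b x a) a)     ≡⟨ additiveʳ x (x · L) (scale (b x a) a) ⟨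
    b x ((x · L) +ᵥ scale (b x a) a)          ≡⟨ cong (λ v → b x ((x · L) +ᵥ v)) (·-E x a a) ⟨
    b x ((x · L) +ᵥ (x · E b a a))            ≡⟨ cong (b x) (combination-distrib x L (E b a a)) ⟨
    b x (x · (L +ₒ E b a a))                  ≡⟨ skew x ⟩
    false                                     ∎)

  E-distribˡ : ∀ a u c → E b (a +ᵥ u) c ≡ E b a c +ₒ E b u c
  E-distribˡ a u c = trans (tabulate-cong λ i → trans (cong (λ t → scale t c) (additiveʳ (basis i) a u))
                                                      (scale-distribʳ-xor _ _ c))
                           (sym (zipWith-tabulate _+ᵥ_ _ _))

  E-distribʳ : ∀ a c d → E b a (c +ᵥ d) ≡ E b a c +ₒ E b a d
  E-distribʳ a c d = trans (tabulate-cong λ i → scale-distribˡ-+ᵥ (b (basis i) a) c d)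
                           (sym (zipWith-tabulate _+ᵥ_ _ _))

  E-diagonal-+ : ∀ a u → E b (a +ᵥ u) (a +ᵥ u) ≡ (E b a a +ₒ E b a u) +ₒ (E b u a +ₒ E b u u)
  E-diagonal-+ a u = trans (E-distribˡ a u (a +ᵥ u)) (cong₂ _+ₒ_ (E-distribʳ a a u) (E-distribʳ u a u))

module CanonicalLabeling {n : ℕ} {b : U n → U n → Bool} (bl : IsNondegSymBilinear b)
                         {S : Op n → Set} (closed : AdditivelyClosed S)
                         {C : U n → Op n} (lab : IsCanonicalLabeling b S C) where
  open IsNondegSymBilinear bl
  open IsCanonicalLabeling lab
  open Bilinear bl

  b-·C : ∀ a x → b x (x · C a) ≡ b x a
  b-·C a = skew-shift (C a) a (skew a)

  C-additive : ∀ a u → C (a +ᵥ u) ≡ C a +ₒ C u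
  C-additive a u with surjective (C a +ₒ C u) (closed _ _ (into a) (into u))
  ... | w , Cw≡Ca+Cu = trans (cong C (sym w≡a+u)) Cw≡Ca+Cu
    where
    w≡a+u : w ≡ a +ᵥ u
    w≡a+u = separating w (a +ᵥ u) λ x → begin
      b x w                              ≡⟨ b-·C w x ⟨
      b x (x · C w)                      ≡⟨ cong (λ L → b x (x · L)) Cw≡Ca+Cu ⟩
      b x (x · (C a +ₒ C u))             ≡⟨ cong (b x) (combination-distrib x (C a) (C u)) ⟩
      b x ((x · C a) +ᵥ (x · C u))       ≡⟨ additiveʳ x (x · C a) (x · C u) ⟩
      b x (x · C a) xor b x (x · C u)    ≡⟨ cong₂ _xor_ (b-·C a x) (b-·C u x) ⟩
      b x a xor b x u                    ≡⟨ additiveʳ x a u ⟨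
      b x (a +ᵥ u)                       ∎

  twisted-shadow-+ : ∀ u a → Bᵤ b C u a +ₒ B b C u ≡ B b C (a +ᵥ u)
  twisted-shadow-+ u a = begin
    (((C a +ₒ E b a u) +ₒ E b u a) +ₒ E b a a) +ₒ (C u +ₒ E b u u)
      ≡⟨ +ₒ.solve 6 (λ ca cu eau eua eaa euu →
             (((ca ⊕ eau) ⊕ eua) ⊕ eaa) ⊕ (cu ⊕ euu) ⊜ (ca ⊕ cu) ⊕ ((eaa ⊕ eau) ⊕ (eua ⊕ euu)))
           refl (C a) (C u) (E b a u) (E b u a) (E b a a) (E b u u) ⟩
    (C a +ₒ C u) +ₒ ((E b a a +ₒ E b a u) +ₒ (E b u a +ₒ E b u u))
      ≡⟨ cong₂ _+ₒ_ (C-additive a u) (E-diagonal-+ a u) ⟨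
    C (a +ᵥ u) +ₒ E b (a +ᵥ u) (a +ᵥ u)
      ∎
    where open +ₒ using (_⊕_; _⊜_)

-- Inversion is the identity in
-- characteristic 2, so x // y below is x +ₒ y.
corollary3p19 : (n : ℕ) → Odd n →
    (b : U n → U n → Bool) → IsNondegSymBilinear b →
    (S : Op n → Set) → IsSymplecticSpreadSet b S → AdditivelyClosed S →
    (C : U n → Op n) → IsCanonicalLabeling b S C →
    (u : U n) → ∀ a → Bᵤ b C u a ≡ B b C (a +ᵥ u) +ₒ B b C u
corollary3p19 _ _ b bl _ _ closed C lab u a = begin
  Bᵤ b C u a                             ≡⟨ +ₒ.//-rightDividesʳ (B b C u) (Bᵤ b C u a) ⟨
  (Bᵤ b C u a +ₒ B b C u) +ₒ B b C u     ≡⟨ cong (_+ₒ B b C u) (twisted-shadow-+ u a) ⟩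
  B b C (a +ᵥ u) +ₒ B b C u              ∎
  where open CanonicalLabeling bl closed lab
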